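{- Let $G$ be a graph on $n$ vertices and let $k$ be a positive integer. If $f(G) < k$, then there exist sets $V_1, V_2, \dots, V_n \subseteq V(G)$ such that $|V_i| \leq k$ for all $i$ and $E(G) \subseteq \bigcup_{i=1}^n E(G[V_i])$.
   Context: $G[V_i]$ denotes the subgraph of $G$ induced by $V_i$. An edge-ordering of a graph $G=(V,E)$ is a bijection $\phi:E\to\{1,\ldots,|E|\}$. Given an edge-ordering $\phi$, a sequence of edges $e_1,\ldots,e_k$ is an increasing path of length $k$ if it forms a path in $G$ and $\phi(e_i)<\phi(e_j)$ for all $i<j$. $f(G)$ denotes the largest integer $\ell$ such that every edge-ordering of $G$ contains an increasing path of length $\ell$. -}

module Defs where

open import Data.Nat using (ℕ; suc; _≤_; _<_)
open import Data.Fin using (Fin; inject₁) renaming (suc to fsuc; _<_ to _<ᶠ_)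
open import Data.Fin.Subset using (Subset; _∈_; ∣_∣)
open import Data.Product using (Σ; ∃; _×_; _,_; proj₁; proj₂)
open import Data.Sum using (_⊎_)
open import Relation.Nullary using (¬_)
open import Relation.Binary.PropositionalEquality using (_≡_)
open import Function.Definitions using (Injective; Bijective)

record Graph (n : ℕ) : Set where
  field
    m         : ℕ
    edge      : Fin m → Fin n × Fin n
    loopless  : ∀ e → ¬ (proj₁ (edge e) ≡ proj₂ (edge e))
    simple    : ∀ e e′ →
                (edge e ≡ edge e′ ⊎ edge e ≡ (proj₂ (edge e′) , proj₁ (edge e′))) →
                e ≡ e′
open Graph public

Joins : ∀ {n} (G : Graph n) → Fin (m G) → Fin n → Fin n → Set
Joins G e u v = edge G e ≡ (u , v) ⊎ edge G e ≡ (v , u)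

-- An edge-ordering: a bijection from E(G) to {1,…,|E|}; we use labels
-- {0,…,|E|-1} = Fin |E|, which only shifts labels and preserves their order.
EdgeOrdering : ∀ {n} → Graph n → Set
EdgeOrdering G = Σ (Fin (m G) → Fin (m G)) λ φ → Bijective _≡_ _≡_ φ

record IncreasingPath {n} (G : Graph n) (φ : EdgeOrdering G) (k : ℕ) : Set where
  field
    vert      : Fin (suc k) → Fin n
    vert-inj  : Injective _≡_ _≡_ vert
    edges     : Fin k → Fin (m G)
    joins     : ∀ i → Joins G (edges i) (vert (inject₁ i)) (vert (fsuc i))
    increasing : ∀ i j → i <ᶠ j → proj₁ φ (edges i) <ᶠ proj₁ φ (edges j)

IsF : ∀ {n} → Graph n → ℕ → Set
IsF G ℓ = ((φ : EdgeOrdering G) → IncreasingPath G φ ℓ)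
        × (∀ ℓ′ → ((φ : EdgeOrdering G) → IncreasingPath G φ ℓ′) → ℓ′ ≤ ℓ)

CoveredBy : ∀ {n} (G : Graph n) → (Fin n → Subset n) → Set
CoveredBy {n} G V = ∀ e → ∃ λ (i : Fin n) →
  (proj₁ (edge G e) ∈ V i) × (proj₂ (edge G e) ∈ V i)

module Submission where

-- Fix an edge-ordering φ.  Scan the edges from the latest label down to the
-- earliest and keep, for every vertex w, a chain: an increasing path starting
-- at w whose labels are all at least the current label.  When the edge e = uv
-- is reached and neither endpoint already lies on the chain of the other, the
-- chains of u and v are swapped and e is put in front of each.  Every vertex
-- set of a chain only grows (it moves to another vertex), and afterwards the
-- chain of u contains both u and v.  Hence at the end the n chain vertex sets
-- span every edge: either some chain has k edges, giving an increasing path of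
-- length k, or all of them have at most k vertices (`pathOrCover`).
--
-- The theorem is then a finite case distinction: the existence of a small cover
-- is decidable by exhaustive search (`smallCover?`).  If no small cover exists,
-- every ordering contains an increasing path of length k, so k ≤ f(G).

open import Defs
open import Data.Nat using (ℕ; zero; suc; _≤_; _<_; _+_; z≤n; s≤s; _≤?_)
open import Data.Nat.Properties
  using (≤-trans; ≤-reflexive; n≤1+n; m≤n+m; +-suc; +-identityʳ; +-monoʳ-≤; +-mono-≤;
         <⇒≤; <⇒≱; ≰⇒>; <-≤-trans; m≤n⇒m<n∨m≡n)
open import Data.Fin using (Fin; toℕ; fromℕ<; inject₁)
  renaming (zero to fzero; suc to fsuc; _≟_ to _≟ᶠ_; _<_ to _<ᶠ_)
open import Data.Fin.Properties using (toℕ<n; toℕ-fromℕ<; toℕ-injective; any?; all?)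
open import Data.Fin.Subset using (Subset; _∈_; _∉_; _⊆_; _∪_; ⁅_⁆; ∣_∣; inside; outside)
open import Data.Fin.Subset.Properties
  using (_∈?_; anySubset?; x∈⁅x⁆; ∣⁅x⁆∣≡1; p⊆p∪q; q⊆p∪q; ∣p∣≤∣x∷p∣; ⊆-reflexive)
open import Data.Vec using (Vec; []; _∷_; lookup; tabulate)
open import Data.Vec.Properties using (lookup∘tabulate)
open import Data.Product using (∃; _×_; _,_; proj₁; proj₂)
open import Data.Sum using (_⊎_; inj₁; inj₂; [_,_]′)
open import Function using (id; _∘_)
open import Relation.Nullary using (Dec; yes; no; contradiction)
open import Relation.Nullary.Decidable using (map′; _×-dec_)
open import Relation.Unary using (Decidable)
open import Relation.Binary.PropositionalEquality using (_≡_; _≢_; refl; sym; trans; cong; subst)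

∣p∪q∣≤∣p∣+∣q∣ : ∀ {n} (p q : Subset n) → ∣ p ∪ q ∣ ≤ ∣ p ∣ + ∣ q ∣
∣p∪q∣≤∣p∣+∣q∣ [] [] = z≤n
∣p∪q∣≤∣p∣+∣q∣ (inside ∷ p) (s ∷ q) =
  s≤s (≤-trans (∣p∪q∣≤∣p∣+∣q∣ p q) (+-monoʳ-≤ ∣ p ∣ (∣p∣≤∣x∷p∣ s q)))
∣p∪q∣≤∣p∣+∣q∣ (outside ∷ p) (inside ∷ q) =
  ≤-trans (s≤s (∣p∪q∣≤∣p∣+∣q∣ p q)) (≤-reflexive (sym (+-suc ∣ p ∣ ∣ q ∣)))
∣p∪q∣≤∣p∣+∣q∣ (outside ∷ p) (outside ∷ q) = ∣p∪q∣≤∣p∣+∣q∣ p q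

-- A type is searchable if existence of an element with a decidable property
-- is decidable; finite types are, and this is how "no small cover" is decided.
Searchable : Set → Set₁
Searchable A = ∀ {P : A → Set} → Decidable P → Dec (∃ P)

vec-searchable : ∀ {A} → Searchable A → ∀ n → Searchable (Vec A n)
vec-searchable search zero P? = map′ ([] ,_) (λ { ([] , p) → p }) (P? [])
vec-searchable search (suc n) P? =
  map′ (λ { (x , xs , p) → x ∷ xs , p }) (λ { (x ∷ xs , p) → x , xs , p })
       (search (λ x → vec-searchable search n (λ xs → P? (x ∷ xs))))

override : ∀ {n} {P : Fin n → Set} → ((w : Fin n) → P w) → (u : Fin n) → P u → (w : Fin n) → P w
override f u x w with w ≟ᶠ u
... | yes refl = x
... | no _ = f w

override-here : ∀ {n} {P : Fin n → Set} (f : (w : Fin n) → P w) u (x : P u) → override f u x u ≡ x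
override-here f u x with u ≟ᶠ u
... | yes refl = refl
... | no u≢u = contradiction refl u≢u

override-there : ∀ {n} {P : Fin n → Set} (f : (w : Fin n) → P w) u (x : P u) {w} →
                 w ≢ u → override f u x w ≡ f w
override-there f u x {w} w≢u with w ≟ᶠ u
... | yes w≡u = contradiction w≡u w≢u
... | no _ = refl

-- Downward induction: a property of N that passes from suc t down to t for
-- every t < N holds at 0.  The edges are processed in this order.
downward : (P : ℕ → Set) {N : ℕ} → P N → (∀ t → t < N → P (suc t) → P t) → P 0
downward P {N} base step = go N 0 (+-identityʳ N)
  where
  go : ∀ d t → d + t ≡ N → P t
  go zero t refl = base
  go (suc d) t eq = step t (subst (t <_) eq (s≤s (m≤n+m t d))) (go d (suc t) (trans (+-suc d t) eq))

Spans : ∀ {n} (G : Graph n) → Subset n → Fin (m G) → Set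
Spans G S e = proj₁ (edge G e) ∈ S × proj₂ (edge G e) ∈ S

spans-⊆ : ∀ {n} (G : Graph n) e {S T : Subset n} → S ⊆ T → Spans G S e → Spans G T e
spans-⊆ G e S⊆T (x∈S , y∈S) = S⊆T x∈S , S⊆T y∈S

SmallCover : ∀ {n} (G : Graph n) (k : ℕ) → (Fin n → Subset n) → Set
SmallCover G k V = (∀ i → ∣ V i ∣ ≤ k) × CoveredBy G V

smallCover-cong : ∀ {n} {G : Graph n} {k} {V W : Fin n → Subset n} →
                  (∀ i → V i ≡ W i) → SmallCover G k V → SmallCover G k W
smallCover-cong {G = G} {k} V≗W (small , covers) =
    (λ i → subst (λ S → ∣ S ∣ ≤ k) (V≗W i) (small i))
  , λ e → let (i , spans) = covers e in i , subst (λ S → Spans G S e) (V≗W i) spans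

smallCover? : ∀ {n} (G : Graph n) (k : ℕ) → Dec (∃ (SmallCover G k))
smallCover? {n} G k =
  map′ (λ { (Vs , c) → lookup Vs , c })
       (λ { (V , c) → tabulate V , smallCover-cong {G = G} (λ i → sym (lookup∘tabulate V i)) c })
       (vec-searchable anySubset? n {P = SmallCover G k ∘ lookup} (isSmallCover? ∘ lookup))
  where
  isSmallCover? : (V : Fin n → Subset n) → Dec (SmallCover G k V)
  isSmallCover? V =
    all? (λ i → ∣ V i ∣ ≤? k) ×-dec
    all? (λ e → any? (λ i → (proj₁ (edge G e) ∈? V i) ×-dec (proj₂ (edge G e) ∈? V i)))

module Greedy {n} (G : Graph n) (φ : EdgeOrdering G) where

  label : Fin (m G) → ℕ
  label e = toℕ (proj₁ φ e)

  labelled : ∀ t → t < m G → ∃ λ e → label e ≡ t × (∀ e′ → label e′ ≡ t → e′ ≡ e)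
  labelled t t<m =
    let (e , hits) = proj₂ (proj₂ φ) (fromℕ< t<m)
        label-e = trans (cong toℕ (hits refl)) (toℕ-fromℕ< t<m)
    in e , label-e , λ e′ eq → proj₁ (proj₂ φ) (toℕ-injective (trans eq (sym label-e)))

  record Anchored (w : Fin n) (b : ℕ) (S : Subset n) (k : ℕ) : Set where
    field
      path   : IncreasingPath G φ k
      starts : IncreasingPath.vert path fzero ≡ w
      within : ∀ i → IncreasingPath.vert path i ∈ S
      above  : ∀ i → b ≤ label (IncreasingPath.edges path i)

  single : ∀ {w b S} → w ∈ S → Anchored w b S 0
  single {w} w∈S = record
    { path   = record { vert = λ _ → w ; vert-inj = λ { {fzero} {fzero} _ → refl }
                      ; edges = λ () ; joins = λ () ; increasing = λ () }
    ; starts = refl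
    ; within = λ { fzero → w∈S }
    ; above  = λ () }

  prepend : ∀ {w v b b′ S k} (e : Fin (m G)) → Joins G e w v → b ≤ label e → label e < b′ →
            w ∉ S → Anchored v b′ S k → Anchored w b (⁅ w ⁆ ∪ S) (suc k)
  prepend {w} {v} {b} {b′} {S} {k} e J b≤e e<b′ w∉S A = record
    { path   = record { vert = vert ; vert-inj = injective ; edges = edges
                      ; joins = joins ; increasing = increasing }
    ; starts = refl
    ; within = within
    ; above  = above }
    where
    module A = Anchored A
    module P = IncreasingPath A.path

    vert : Fin (suc (suc k)) → Fin n
    vert fzero = w
    vert (fsuc i) = P.vert i

    within : ∀ i → vert i ∈ ⁅ w ⁆ ∪ S
    within fzero = p⊆p∪q S (x∈⁅x⁆ w)
    within (fsuc i) = q⊆p∪q ⁅ w ⁆ S (A.within i)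

    -- w is new because the old path stays inside S.
    injective : ∀ {i j} → vert i ≡ vert j → i ≡ j
    injective {fzero} {fzero} _ = refl
    injective {fzero} {fsuc j} w≡ = contradiction (subst (_∈ S) (sym w≡) (A.within j)) w∉S
    injective {fsuc i} {fzero} ≡w = contradiction (subst (_∈ S) ≡w (A.within i)) w∉S
    injective {fsuc i} {fsuc j} eq = cong fsuc (P.vert-inj eq)

    edges : Fin (suc k) → Fin (m G)
    edges fzero = e
    edges (fsuc i) = P.edges i

    joins : ∀ i → Joins G (edges i) (vert (inject₁ i)) (vert (fsuc i))
    joins fzero = subst (Joins G e w) (sym A.starts) J
    joins (fsuc i) = P.joins i

    e-first : ∀ i → label e < label (P.edges i)
    e-first i = <-≤-trans e<b′ (A.above i)

    increasing : ∀ i j → i <ᶠ j → proj₁ φ (edges i) <ᶠ proj₁ φ (edges j)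
    increasing fzero (fsuc j) _ = e-first j
    increasing (fsuc i) (fsuc j) (s≤s i<j) = P.increasing i j i<j
    increasing _ fzero ()

    above : ∀ i → b ≤ label (edges i)
    above fzero = b≤e
    above (fsuc i) = ≤-trans b≤e (<⇒≤ (e-first i))

  data Chain : Fin n → ℕ → Set
  vertices : ∀ {w b} → Chain w b → Subset n

  data Chain where
    trivial : ∀ {w b} → Chain w b
    cons    : ∀ {w v b b′} (e : Fin (m G)) → Joins G e w v → b ≤ label e → label e < b′ →
              (c : Chain v b′) → w ∉ vertices c → Chain w b

  vertices {w} trivial = ⁅ w ⁆
  vertices {w} (cons _ _ _ _ c _) = ⁅ w ⁆ ∪ vertices c

  len : ∀ {w b} → Chain w b → ℕ
  len trivial = 0
  len (cons _ _ _ _ c _) = suc (len c)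

  start∈ : ∀ {w b} (c : Chain w b) → w ∈ vertices c
  start∈ {w} trivial = x∈⁅x⁆ w
  start∈ {w} (cons _ _ _ _ c _) = p⊆p∪q (vertices c) (x∈⁅x⁆ w)

  ∣vertices∣≤ : ∀ {w b} (c : Chain w b) → ∣ vertices c ∣ ≤ suc (len c)
  ∣vertices∣≤ {w} trivial = ≤-reflexive (∣⁅x⁆∣≡1 w)
  ∣vertices∣≤ {w} (cons _ _ _ _ c _) =
    ≤-trans (∣p∪q∣≤∣p∣+∣q∣ ⁅ w ⁆ (vertices c)) (+-mono-≤ (≤-reflexive (∣⁅x⁆∣≡1 w)) (∣vertices∣≤ c))

  weaken : ∀ {w b b′} → b ≤ b′ → Chain w b′ → Chain w b
  weaken _ trivial = trivial
  weaken b≤b′ (cons e J b′≤e e<b″ c w∉) = cons e J (≤-trans b≤b′ b′≤e) e<b″ c w∉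

  vertices-weaken : ∀ {w b b′} (b≤b′ : b ≤ b′) (c : Chain w b′) → vertices (weaken b≤b′ c) ≡ vertices c
  vertices-weaken _ trivial = refl
  vertices-weaken _ (cons _ _ _ _ _ _) = refl

  realise : ∀ {w b} k (c : Chain w b) → k ≤ len c → Anchored w b (vertices c) k
  realise zero c _ = single (start∈ c)
  realise (suc k) trivial ()
  realise (suc k) (cons e J b≤e e<b′ c w∉) (s≤s k≤) = prepend e J b≤e e<b′ w∉ (realise k c k≤)

  record Stage (t : ℕ) : Set where
    field
      chain   : (w : Fin n) → Chain w t
      covered : ∀ e → t ≤ label e → ∃ λ w → Spans G (vertices (chain w)) e

  -- No label reaches |E|, so trivial chains form the stage |E|.
  initial : Stage (m G)
  initial = record
    { chain   = λ _ → trivial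
    ; covered = λ e |E|≤ → contradiction |E|≤ (<⇒≱ (toℕ<n (proj₁ φ e))) }

  module Process {t} (S : Stage (suc t)) (e : Fin (m G)) (label-e : label e ≡ t)
                 (unique : ∀ e′ → label e′ ≡ t → e′ ≡ e) where
    open Stage S

    u v : Fin n
    u = proj₁ (edge G e)
    v = proj₂ (edge G e)

    advance : (chain′ : (w : Fin n) → Chain w t) →
              (∀ w → ∃ λ w′ → vertices (chain w) ⊆ vertices (chain′ w′)) →
              (∃ λ w → Spans G (vertices (chain′ w)) e) → Stage t
    advance chain′ grows (w₀ , spans-e) = record { chain = chain′ ; covered = covered′ }
      where
      covered′ : ∀ e′ → t ≤ label e′ → ∃ λ w → Spans G (vertices (chain′ w)) e′
      covered′ e′ t≤ with m≤n⇒m<n∨m≡n t≤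
      ... | inj₁ t< = let (w , spans) = covered e′ t< ; (w′ , ⊆′) = grows w in w′ , spans-⊆ G e′ ⊆′ spans
      ... | inj₂ t≡ with unique e′ (sym t≡)
      ... | refl = w₀ , spans-e

    carried : (w : Fin n) → Chain w t
    carried w = weaken (n≤1+n t) (chain w)

    carried-⊇ : ∀ w → vertices (chain w) ⊆ vertices (carried w)
    carried-⊇ w = ⊆-reflexive (sym (vertices-weaken (n≤1+n t) (chain w)))

    keep : ∀ w → ∃ λ w′ → vertices (chain w) ⊆ vertices (carried w′)
    keep w = w , carried-⊇ w

    module Swap (u∉ : u ∉ vertices (chain v)) (v∉ : v ∉ vertices (chain u)) where

      extend : ∀ x y → Joins G e x y → x ∉ vertices (chain y) → Chain x t
      extend x y J x∉ = cons e J (≤-reflexive (sym label-e)) (s≤s (≤-reflexive label-e)) (chain y) x∉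

      shifted-u : Chain u t
      shifted-u = extend u v (inj₁ refl) u∉

      shifted-v : Chain v t
      shifted-v = extend v u (inj₂ refl) v∉

      swapped : (w : Fin n) → Chain w t
      swapped = override (override carried u shifted-u) v shifted-v

      -- e is not a loop, so the two updates do not interfere.
      u≢v : u ≢ v
      u≢v = loopless G e

      at-u : vertices (swapped u) ≡ ⁅ u ⁆ ∪ vertices (chain v)
      at-u = cong vertices (trans (override-there _ v shifted-v u≢v) (override-here carried u shifted-u))

      at-v : vertices (swapped v) ≡ ⁅ v ⁆ ∪ vertices (chain u)
      at-v = cong vertices (override-here _ v shifted-v)

      elsewhere : ∀ {w} → w ≢ u → w ≢ v → swapped w ≡ carried w
      elsewhere w≢u w≢v = trans (override-there _ v shifted-v w≢v) (override-there carried u shifted-u w≢u)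

      grows : ∀ w → ∃ λ w′ → vertices (chain w) ⊆ vertices (swapped w′)
      grows w with w ≟ᶠ u | w ≟ᶠ v
      ... | yes refl | _ = v , subst (vertices (chain u) ⊆_) (sym at-v) (q⊆p∪q ⁅ v ⁆ _)
      ... | no _ | yes refl = u , subst (vertices (chain v) ⊆_) (sym at-u) (q⊆p∪q ⁅ u ⁆ _)
      ... | no w≢u | no w≢v =
        w , subst (λ c → vertices (chain w) ⊆ vertices c) (sym (elsewhere w≢u w≢v)) (carried-⊇ w)

      spans-e : Spans G (vertices (swapped u)) e
      spans-e = subst (λ T → Spans G T e) (sym at-u)
                      (p⊆p∪q _ (x∈⁅x⁆ u) , q⊆p∪q ⁅ u ⁆ _ (start∈ (chain v)))

    next : Stage t
    next with u ∈? vertices (chain v) | v ∈? vertices (chain u)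
    ... | yes u∈ | _ = advance carried keep (v , spans-⊆ G e (carried-⊇ v) (u∈ , start∈ (chain v)))
    ... | no _ | yes v∈ = advance carried keep (u , spans-⊆ G e (carried-⊇ u) (start∈ (chain u) , v∈))
    ... | no u∉ | no v∉ = advance swapped grows (u , spans-e)
      where open Swap u∉ v∉

  final : Stage 0
  final = downward Stage initial λ t t<m S →
    let (e , label-e , unique) = labelled t t<m in Process.next S e label-e unique

  pathOrCover : (k : ℕ) → IncreasingPath G φ k ⊎ ∃ (SmallCover G k)
  pathOrCover k = decide (any? (λ w → k ≤? len (chain w)))
    where
    open Stage final

    decide : Dec (∃ λ w → k ≤ len (chain w)) → IncreasingPath G φ k ⊎ ∃ (SmallCover G k)
    decide (yes (w , k≤)) = inj₁ (Anchored.path (realise k (chain w) k≤))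
    decide (no noLong) = inj₂ ((λ w → vertices (chain w)) , small , λ e → covered e z≤n)
      where
      small : ∀ w → ∣ vertices (chain w) ∣ ≤ k
      small w = ≤-trans (∣vertices∣≤ (chain w)) (≰⇒> λ k≤ → noLong (w , k≤))

lemma1 : ∀ {n} (G : Graph n) (k : ℕ) → 1 ≤ k →
    ∀ (f : ℕ) → IsF G f → f < k →
    ∃ λ (V : Fin n → Subset n) → (∀ i → ∣ V i ∣ ≤ k) × CoveredBy G V
lemma1 G k _ f (_ , maximal) f<k with smallCover? G k
... | yes cover = cover
... | no noCover = contradiction (maximal k increasingPath) (<⇒≱ f<k)
  where
  increasingPath : (φ : EdgeOrdering G) → IncreasingPath G φ k
  increasingPath φ = [ id , (λ cover → contradiction cover noCover) ]′ (Greedy.pathOrCover G φ k)
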